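{- Let $g$ be a good counter on a finite graph $G$, let $X,Y\subseteq V(G)$ be disjoint, and let $u,v\in V(G)\setminus(X\cup Y)$. If $g(X,Y)=g(X\cup\{u,v\},Y)\neq 0$, then $g(X,Y)=g(X\cup\{v\},Y)$.
   Context: All graphs are finite with no loops or parallel edges. For disjoint $X,Y\subseteq V(G)$, $f_G(X,Y)$ is the sum of $(-1)^{|A|}$ over all stable sets $A$ of $G$ with $X\subseteq A$ and $A\cap Y=\emptyset$. A counter on $G$ is either of the functions $f_G$ or $-f_G$. For a counter $g$ and $X\subseteq V(G)$ write $g(X)=g(X,\emptyset)$. A counter $g$ is good if for all disjoint $X,Y\subseteq V(G)$ with $X\cup Y\neq\emptyset$: (i) $|g(X,Y)|\le 1$; and (ii) $|g(X\cup\{u\},Y)-g(X\cup\{v\},Y)|\le 1$ for all $u,v\in V(G)\setminus(X\cup Y)$. -}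

module Defs where

open import Data.Nat using (ℕ; zero; suc; _≤_)
open import Data.Bool using (Bool; true; false; _∧_; _∨_; not; if_then_else_)
open import Data.Fin using (Fin)
open import Data.Fin.Subset using (Subset; _∈_; _∉_; ∣_∣; _∪_; ⁅_⁆; Empty; _∩_)
open import Data.Vec using (Vec; []; _∷_; lookup)
open import Data.List using (List; []; _∷_; map; _++_; foldr)
open import Data.Integer using (ℤ; +_; -_; _+_; _-_)
import Data.Integer as ℤ
open import Data.Product using (_×_; _,_; Σ)
open import Data.Sum using (_⊎_)
open import Relation.Binary.PropositionalEquality using (_≡_; _≢_)

record Graph (n : ℕ) : Set where
  field
    adj     : Fin n → Fin n → Bool
    symm    : ∀ i j → adj i j ≡ adj j i
    irrefl  : ∀ i → adj i i ≡ false
open Graph public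

allSubsets : (n : ℕ) → List (Subset n)
allSubsets zero = [] ∷ []
allSubsets (suc n) = map (true ∷_) (allSubsets n) ++ map (false ∷_) (allSubsets n)

allFin : (n : ℕ) → List (Fin n)
allFin n = Data.List.allFin n

allB : ∀ {A : Set} → (A → Bool) → List A → Bool
allB p [] = true
allB p (x ∷ xs) = p x ∧ allB p xs

mem : ∀ {n} → Fin n → Subset n → Bool
mem i A = lookup A i

isStable : ∀ {n} → Graph n → Subset n → Bool
isStable {n} G A =
  allB (λ i → allB (λ j → not (mem i A ∧ mem j A ∧ adj G i j)) (allFin n)) (allFin n)

subsetB : ∀ {n} → Subset n → Subset n → Bool
subsetB {n} X A = allB (λ i → not (mem i X) ∨ mem i A) (allFin n)

disjointB : ∀ {n} → Subset n → Subset n → Bool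
disjointB {n} A Y = allB (λ i → not (mem i A ∧ mem i Y)) (allFin n)

sign : ℕ → ℤ
sign zero = + 1
sign (suc k) = - sign k

f : ∀ {n} → Graph n → Subset n → Subset n → ℤ
f {n} G X Y =
  foldr (λ A s → (if isStable G A ∧ subsetB X A ∧ disjointB A Y then sign ∣ A ∣ else + 0) + s)
        (+ 0) (allSubsets n)

-- A counter on G: either f_G or -f_G (encoded by a Boolean choice of sign)
counter : ∀ {n} → Graph n → Bool → Subset n → Subset n → ℤ
counter G true  X Y = f G X Y
counter G false X Y = - f G X Y

Disj : ∀ {n} → Subset n → Subset n → Set
Disj X Y = ∀ i → i ∈ X → i ∉ Y

NonemptyS : ∀ {n} → Subset n → Set
NonemptyS X = Σ _ (λ i → i ∈ X)

Good : ∀ {n} → (Subset n → Subset n → ℤ) → Set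
Good {n} g = ∀ (X Y : Subset n) → Disj X Y → NonemptyS (X ∪ Y) →
    (ℤ.∣ g X Y ∣ ≤ 1)
  × (∀ (u v : Fin n) → u ∉ X ∪ Y → v ∉ X ∪ Y →
       ℤ.∣ g (X ∪ ⁅ u ⁆) Y - g (X ∪ ⁅ v ⁆) Y ∣ ≤ 1)

module Submission where

-- Three identities for f = f_G carry the argument, each proved summand by summand after the
-- Boolean counting condition in the definition of f is reflected into propositions:
--   split:    f(X,Y) = f(X+z,Y) + f(X,Y+z);
--   adjacent: f(X,Y) = 0 when X contains an edge;
--   pendant:  f(X,Y) = 0 when some v ∉ X ∪ Y has all its neighbours in Y, because toggling v
--             is a sign-reversing involution on the stable sets counted by f(X,Y).
-- The theorem is proved by well-founded induction on X ∪ Y.  If u ≠ v and g(X,Y) ≠ g(X+v,Y),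
-- then v has no neighbour in X ∪ {u} (adjacent), so either all neighbours of v are in Y, and
-- g(X,Y) = 0 (pendant), or v has a free neighbour w.  In the latter case splitting at u, v, w
-- writes every value of g at (X,Y) extended by u, v, w as a sum of six atomic values in
-- {-1,0,1}; the hypotheses, goodness and the induction hypotheses at (X,Y+v) and (X,Y+w) give
-- integer constraints on these six values that a finite check over all 3⁶ tables refutes.

open import Defs
open import Data.Nat using (ℕ; zero; suc; _≤_; s≤s)
import Data.Nat as ℕ
open import Data.Bool using (Bool; true; false; _∧_; _∨_; not; if_then_else_)
import Data.Bool as 𝔹
open import Data.Bool.Properties using (not-involutive; ¬-not; not-¬)
open import Data.Fin using (Fin; zero; suc)
open import Data.Fin.Properties using (all?; any?) renaming (_≟_ to _≟ᶠ_)
open import Data.Fin.Subset using (Subset; _∈_; _∉_; _⊆_; _⊂_; _⊃_; _∪_; ⁅_⁆; ∣_∣)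
open import Data.Fin.Subset.Induction using (⊃-wellFounded)
open import Induction.WellFounded using (Acc; acc)
open import Data.Fin.Subset.Properties using (x∈p∪q⁺; x∈p∪q⁻; x∈⁅x⁆; x∈⁅y⁆⇒x≡y; p⊆p∪q; ∪-assoc; ∪-comm; ∪-idem; _∈?_)
open import Data.Integer using (ℤ; +_; -[1+_]; -_; _+_; _-_)
import Data.Integer as ℤ
import Data.Integer.Properties as ℤP
open import Algebra.Properties.CommutativeSemigroup ℤP.+-commutativeSemigroup using (interchange)
open import Data.Vec using ([]; _∷_; lookup; _[_]%=_)
open import Data.Vec.Properties using ([]=⇒lookup; lookup⇒[]=; updateAt-minimal; []%=-∘; updateAt-cong; []%=-id)
open import Data.List using (List; []; _∷_; map; _++_; foldr)
open import Data.List.Properties using (foldr-map)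
open import Data.List.Relation.Unary.All as All using (All; []; _∷_)
open import Data.List.Membership.Propositional.Properties using (∈-allFin)
open import Data.Product using (Σ; _×_; _,_; proj₁; proj₂)
open import Data.Sum using (inj₁; inj₂)
open import Data.Empty using (⊥-elim)
open import Function using (_∘_)
open import Function.Bundles using (_⇔_; mk⇔; Equivalence)
open import Relation.Nullary using (¬_; Dec; yes; no)
open import Relation.Nullary.Decidable using (map′; ¬?; _×-dec_; _→-dec_; toWitness)
open import Relation.Binary.PropositionalEquality
open import Data.Unit using (tt)

open Equivalence using (to; from)
open ≡-Reasoning

∧-true : ∀ {a b} → a ∧ b ≡ true ⇔ (a ≡ true × b ≡ true)
∧-true {true}  = mk⇔ (λ e → refl , e) proj₂
∧-true {false} = mk⇔ (λ ()) (λ ())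

allB⇔All : ∀ {A : Set} {p : A → Bool} {xs : List A} →
  allB p xs ≡ true ⇔ All (λ x → p x ≡ true) xs
allB⇔All {xs = []}     = mk⇔ (λ _ → []) (λ _ → refl)
allB⇔All {xs = x ∷ xs} = mk⇔
  (λ e → proj₁ (to ∧-true e) ∷ to allB⇔All (proj₂ (to ∧-true e)))
  (λ { (px ∷ pxs) → from ∧-true (px , from allB⇔All pxs) })

allB-allFin : ∀ {n} {p : Fin n → Bool} → allB p (allFin n) ≡ true ⇔ (∀ i → p i ≡ true)
allB-allFin {n} = mk⇔ (λ e i → All.lookup (to (allB⇔All {xs = allFin n}) e) (∈-allFin i))
                      (λ h → from (allB⇔All {xs = allFin n}) (All.tabulate (λ {i} _ → h i)))

not-true : ∀ {c} → not c ≡ true ⇔ c ≡ false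
not-true {true}  = mk⇔ (λ ()) (λ ())
not-true {false} = mk⇔ (λ _ → refl) (λ _ → refl)

nand₃ : ∀ {a b c} → not (a ∧ b ∧ c) ≡ true ⇔ (a ≡ true → b ≡ true → c ≡ false)
nand₃ {false}         = mk⇔ (λ _ ()) (λ _ → refl)
nand₃ {true} {false}  = mk⇔ (λ _ _ ()) (λ _ → refl)
nand₃ {true} {true}   = mk⇔ (λ e _ _ → to not-true e) (λ h → from not-true (h refl refl))

nand₂ : ∀ {a b} → not (a ∧ b) ≡ true ⇔ (a ≡ true → b ≡ false)
nand₂ {false} = mk⇔ (λ _ ()) (λ _ → refl)
nand₂ {true}  = mk⇔ (λ e _ → to not-true e) (λ h → from not-true (h refl))

implies : ∀ {a b} → not a ∨ b ≡ true ⇔ (a ≡ true → b ≡ true)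
implies {false} = mk⇔ (λ _ ()) (λ _ → refl)
implies {true}  = mk⇔ (λ e _ → e) (λ h → h refl)

∈⇔lookup : ∀ {n} {i : Fin n} {A : Subset n} → i ∈ A ⇔ lookup A i ≡ true
∈⇔lookup {i = i} {A} = mk⇔ []=⇒lookup (lookup⇒[]= i A)

∉⇔lookup : ∀ {n} {i : Fin n} {A : Subset n} → i ∉ A ⇔ lookup A i ≡ false
∉⇔lookup = mk⇔ (λ i∉ → ¬-not (i∉ ∘ from ∈⇔lookup)) (λ e → not-¬ e ∘ to ∈⇔lookup)

Stable : ∀ {n} → Graph n → Subset n → Set
Stable G A = ∀ i j → i ∈ A → j ∈ A → adj G i j ≡ false

stable⇔ : ∀ {n} {G : Graph n} {A : Subset n} → isStable G A ≡ true ⇔ Stable G A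
stable⇔ {n} = mk⇔
  (λ e i j i∈ j∈ → to nand₃ (to (allB-allFin {n}) (to (allB-allFin {n}) e i) j) (to ∈⇔lookup i∈) (to ∈⇔lookup j∈))
  (λ s → from (allB-allFin {n}) λ i → from (allB-allFin {n}) λ j →
           from nand₃ (λ i∈ j∈ → s i j (from ∈⇔lookup i∈) (from ∈⇔lookup j∈)))

subset⇔ : ∀ {n} {X A : Subset n} → subsetB X A ≡ true ⇔ X ⊆ A
subset⇔ {n} = mk⇔
  (λ e {i} i∈ → from ∈⇔lookup (to implies (to (allB-allFin {n}) e i) (to ∈⇔lookup i∈)))
  (λ X⊆A → from (allB-allFin {n}) λ i → from implies (λ i∈ → to ∈⇔lookup (X⊆A (from ∈⇔lookup i∈))))

disjoint⇔ : ∀ {n} {A Y : Subset n} → disjointB A Y ≡ true ⇔ Disj A Y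
disjoint⇔ {n} = mk⇔
  (λ e i i∈ → from ∉⇔lookup (to nand₂ (to (allB-allFin {n}) e i) (to ∈⇔lookup i∈)))
  (λ d → from (allB-allFin {n}) λ i → from nand₂ (λ i∈ → to ∉⇔lookup (d i (from ∈⇔lookup i∈))))

∈-∪⁅⁆ : ∀ {n} (X : Subset n) (z : Fin n) → z ∈ X ∪ ⁅ z ⁆
∈-∪⁅⁆ X z = x∈p∪q⁺ (inj₂ (x∈⁅x⁆ z))

∉-∪ˡ : ∀ {n} {X Y : Subset n} {i : Fin n} → i ∉ X ∪ Y → i ∉ X
∉-∪ˡ i∉ = i∉ ∘ x∈p∪q⁺ ∘ inj₁

∉-∪ʳ : ∀ {n} {X Y : Subset n} {i : Fin n} → i ∉ X ∪ Y → i ∉ Y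
∉-∪ʳ i∉ = i∉ ∘ x∈p∪q⁺ ∘ inj₂

∉-∪⁅⁆ : ∀ {n} {S : Subset n} {i z : Fin n} → i ∉ S → i ≢ z → i ∉ S ∪ ⁅ z ⁆
∉-∪⁅⁆ {S = S} {i} {z} i∉S i≢z i∈ with x∈p∪q⁻ S ⁅ z ⁆ i∈
... | inj₁ i∈S = i∉S i∈S
... | inj₂ i∈z = i≢z (x∈⁅y⁆⇒x≡y z i∈z)

∪⁅⁆-⊆ : ∀ {n} {X A : Subset n} {z : Fin n} → X ⊆ A → z ∈ A → X ∪ ⁅ z ⁆ ⊆ A
∪⁅⁆-⊆ {X = X} {A} {z} X⊆A z∈A i∈ with x∈p∪q⁻ X ⁅ z ⁆ i∈
... | inj₁ i∈X = X⊆A i∈X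
... | inj₂ i∈z = subst (_∈ A) (sym (x∈⁅y⁆⇒x≡y z i∈z)) z∈A

Disj-sym : ∀ {n} {A B : Subset n} → Disj A B → Disj B A
Disj-sym d i i∈B i∈A = d i i∈A i∈B

Disj-∪⁅⁆ : ∀ {n} {A Y : Subset n} {z : Fin n} → Disj A Y → z ∉ A → Disj A (Y ∪ ⁅ z ⁆)
Disj-∪⁅⁆ {A = A} {Y} {z} d z∉A i i∈A i∈ with x∈p∪q⁻ Y ⁅ z ⁆ i∈
... | inj₁ i∈Y = d i i∈A i∈Y
... | inj₂ i∈z = z∉A (subst (_∈ A) (x∈⁅y⁆⇒x≡y z i∈z) i∈A)

∪-swap : ∀ {n} (S R Q : Subset n) → (S ∪ R) ∪ Q ≡ (S ∪ Q) ∪ R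
∪-swap S R Q = trans (∪-assoc S R Q) (trans (cong (S ∪_) (∪-comm R Q)) (sym (∪-assoc S Q R)))

⊂-grow : ∀ {n} (X Y : Subset n) {z : Fin n} → z ∉ X ∪ Y → X ∪ Y ⊂ X ∪ (Y ∪ ⁅ z ⁆)
⊂-grow X Y {z} z∉ = subst (X ∪ Y ⊂_) (∪-assoc X Y ⁅ z ⁆) (p⊆p∪q ⁅ z ⁆ , z , ∈-∪⁅⁆ (X ∪ Y) z , z∉)

∉-grow : ∀ {n} (X Y : Subset n) {i z : Fin n} → i ∉ X ∪ Y → i ≢ z → i ∉ X ∪ (Y ∪ ⁅ z ⁆)
∉-grow X Y {i} {z} i∉ i≢z = subst (i ∉_) (∪-assoc X Y ⁅ z ⁆) (∉-∪⁅⁆ i∉ i≢z)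

Admissible : ∀ {n} → Graph n → Subset n → Subset n → Subset n → Set
Admissible G X Y A = Stable G A × X ⊆ A × Disj A Y

weight : ∀ {n} → Graph n → Subset n → Subset n → Subset n → ℤ
weight G X Y A = if isStable G A ∧ subsetB X A ∧ disjointB A Y then sign ∣ A ∣ else + 0

admissible⇔ : ∀ {n} {G : Graph n} {X Y A : Subset n} →
  (isStable G A ∧ subsetB X A ∧ disjointB A Y) ≡ true ⇔ Admissible G X Y A
admissible⇔ {G = G} {X} {Y} {A} = mk⇔
  (λ e → let (s , rest) = to ∧-true e ; (x , d) = to ∧-true rest in
         to (stable⇔ {G = G}) s , (λ {_} → to (subset⇔ {X = X}) x) , to (disjoint⇔ {A = A}) d)
  (λ (s , x , d) → from ∧-true (from (stable⇔ {G = G}) s ,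
                                from ∧-true (from (subset⇔ {X = X}) x , from (disjoint⇔ {A = A}) d)))

admissible? : ∀ {n} (G : Graph n) (X Y A : Subset n) → Dec (Admissible G X Y A)
admissible? G X Y A = map′ (to (admissible⇔ {G = G})) (from (admissible⇔ {G = G}))
  ((isStable G A ∧ subsetB X A ∧ disjointB A Y) 𝔹.≟ true)

weight-admissible : ∀ {n} (G : Graph n) (X Y A : Subset n) →
  Admissible G X Y A → weight G X Y A ≡ sign ∣ A ∣
weight-admissible G X Y A adm rewrite from (admissible⇔ {G = G} {X} {Y}) adm = refl

weight-inadmissible : ∀ {n} (G : Graph n) (X Y A : Subset n) →
  ¬ Admissible G X Y A → weight G X Y A ≡ + 0
weight-inadmissible G X Y A ¬adm with isStable G A ∧ subsetB X A ∧ disjointB A Y in e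
... | true  = ⊥-elim (¬adm (to (admissible⇔ {G = G}) e))
... | false = refl

weight-cong : ∀ {n} (G : Graph n) (X Y X′ Y′ A : Subset n) →
  (Admissible G X Y A → Admissible G X′ Y′ A) → (Admissible G X′ Y′ A → Admissible G X Y A) →
  weight G X Y A ≡ weight G X′ Y′ A
weight-cong G X Y X′ Y′ A fwd bwd with admissible? G X Y A
... | yes adm = trans (weight-admissible G X Y A adm) (sym (weight-admissible G X′ Y′ A (fwd adm)))
... | no ¬adm = trans (weight-inadmissible G X Y A ¬adm) (sym (weight-inadmissible G X′ Y′ A (¬adm ∘ bwd)))

sumSubsets : (n : ℕ) → (Subset n → ℤ) → ℤ
sumSubsets zero    h = h []
sumSubsets (suc n) h = sumSubsets n (h ∘ (true ∷_)) + sumSubsets n (h ∘ (false ∷_))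

sumList : ∀ {n} → (Subset n → ℤ) → List (Subset n) → ℤ
sumList h = foldr (λ A s → h A + s) (+ 0)

sumList-++ : ∀ {n} (h : Subset n → ℤ) xs ys → sumList h (xs ++ ys) ≡ sumList h xs + sumList h ys
sumList-++ h []       ys = sym (ℤP.+-identityˡ _)
sumList-++ h (x ∷ xs) ys = trans (cong (λ t → h x + t) (sumList-++ h xs ys)) (sym (ℤP.+-assoc (h x) _ _))

sumList-allSubsets : ∀ n (h : Subset n → ℤ) → sumList h (allSubsets n) ≡ sumSubsets n h
sumList-allSubsets zero    h = ℤP.+-identityʳ (h [])
sumList-allSubsets (suc n) h = trans (sumList-++ h (map (true ∷_) subsets) (map (false ∷_) subsets))
  (cong₂ _+_ (trans (foldr-map _ (true ∷_) (+ 0) subsets) (sumList-allSubsets n (h ∘ (true ∷_))))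
             (trans (foldr-map _ (false ∷_) (+ 0) subsets) (sumList-allSubsets n (h ∘ (false ∷_)))))
  where subsets = allSubsets n

f-as-sum : ∀ {n} (G : Graph n) (X Y : Subset n) → f G X Y ≡ sumSubsets n (weight G X Y)
f-as-sum {n} G X Y = sumList-allSubsets n (weight G X Y)

sumSubsets-cong : ∀ n {h k : Subset n → ℤ} → (∀ A → h A ≡ k A) → sumSubsets n h ≡ sumSubsets n k
sumSubsets-cong zero    h≗k = h≗k []
sumSubsets-cong (suc n) h≗k = cong₂ _+_ (sumSubsets-cong n (h≗k ∘ (true ∷_))) (sumSubsets-cong n (h≗k ∘ (false ∷_)))

sumSubsets-+ : ∀ n (h k : Subset n → ℤ) →
  sumSubsets n (λ A → h A + k A) ≡ sumSubsets n h + sumSubsets n k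
sumSubsets-+ zero    h k = refl
sumSubsets-+ (suc n) h k = trans
  (cong₂ _+_ (sumSubsets-+ n (h ∘ (true ∷_)) (k ∘ (true ∷_))) (sumSubsets-+ n (h ∘ (false ∷_)) (k ∘ (false ∷_))))
  (interchange (sumSubsets n (h ∘ (true ∷_))) (sumSubsets n (k ∘ (true ∷_)))
               (sumSubsets n (h ∘ (false ∷_))) (sumSubsets n (k ∘ (false ∷_))))

sumSubsets-zero : ∀ n {h : Subset n → ℤ} → (∀ A → h A ≡ + 0) → sumSubsets n h ≡ + 0
sumSubsets-zero zero    h≗0 = h≗0 []
sumSubsets-zero (suc n) h≗0 = cong₂ _+_ (sumSubsets-zero n (h≗0 ∘ (true ∷_))) (sumSubsets-zero n (h≗0 ∘ (false ∷_)))

toggle : ∀ {n} → Fin n → Subset n → Subset n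
toggle v A = A [ v ]%= not

toggle-involutive : ∀ {n} (v : Fin n) (A : Subset n) → toggle v (toggle v A) ≡ A
toggle-involutive v A = trans ([]%=-∘ A v) (trans (updateAt-cong v not-involutive A) ([]%=-id A v))

∈-toggle : ∀ {n} {i v : Fin n} {A : Subset n} → i ≢ v → i ∈ A → i ∈ toggle v A
∈-toggle {i = i} {v} {A} i≢v = updateAt-minimal i v A i≢v

toggle-∈ : ∀ {n} {i v : Fin n} {A : Subset n} → i ≢ v → i ∈ toggle v A → i ∈ A
toggle-∈ {i = i} {v} {A} i≢v i∈ = subst (i ∈_) (toggle-involutive v A) (∈-toggle i≢v i∈)

sign-toggle : ∀ {n} (v : Fin n) (A : Subset n) → sign ∣ toggle v A ∣ ≡ - sign ∣ A ∣
sign-toggle zero    (true  ∷ A) = sym (ℤP.neg-involutive (sign ∣ A ∣))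
sign-toggle zero    (false ∷ A) = refl
sign-toggle (suc v) (true  ∷ A) = cong -_ (sign-toggle v A)
sign-toggle (suc v) (false ∷ A) = sign-toggle v A

sumSubsets-toggle : ∀ n (v : Fin n) (h : Subset n → ℤ) → sumSubsets n h ≡ sumSubsets n (h ∘ toggle v)
sumSubsets-toggle (suc n) zero    h = ℤP.+-comm (sumSubsets n (h ∘ (true ∷_))) (sumSubsets n (h ∘ (false ∷_)))
sumSubsets-toggle (suc n) (suc v) h =
  cong₂ _+_ (sumSubsets-toggle n v (h ∘ (true ∷_))) (sumSubsets-toggle n v (h ∘ (false ∷_)))

-- Split: every A counted at (X,Y) is counted at exactly one of (X+z,Y), (X,Y+z).
weight-split : ∀ {n} (G : Graph n) (X Y : Subset n) (z : Fin n) (A : Subset n) →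
  weight G X Y A ≡ weight G (X ∪ ⁅ z ⁆) Y A + weight G X (Y ∪ ⁅ z ⁆) A
weight-split G X Y z A with z ∈? A
... | yes z∈A = begin
  weight G X Y A
    ≡⟨ weight-cong G X Y (X ∪ ⁅ z ⁆) Y A (λ (s , X⊆A , d) → s , ∪⁅⁆-⊆ X⊆A z∈A , d)
                       (λ (s , X⊆A , d) → s , (λ i∈X → X⊆A (p⊆p∪q ⁅ z ⁆ i∈X)) , d) ⟩
  weight G (X ∪ ⁅ z ⁆) Y A
    ≡⟨ ℤP.+-identityʳ _ ⟨
  weight G (X ∪ ⁅ z ⁆) Y A + + 0
    ≡⟨ cong (λ t → weight G (X ∪ ⁅ z ⁆) Y A + t)
            (weight-inadmissible G X (Y ∪ ⁅ z ⁆) A λ (_ , _ , d) → d z z∈A (∈-∪⁅⁆ Y z)) ⟨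
  weight G (X ∪ ⁅ z ⁆) Y A + weight G X (Y ∪ ⁅ z ⁆) A ∎
... | no z∉A = begin
  weight G X Y A
    ≡⟨ weight-cong G X Y X (Y ∪ ⁅ z ⁆) A (λ (s , X⊆A , d) → s , X⊆A , Disj-∪⁅⁆ d z∉A)
                       (λ (s , X⊆A , d) → s , X⊆A , λ i i∈A i∈Y → d i i∈A (p⊆p∪q ⁅ z ⁆ i∈Y)) ⟩
  weight G X (Y ∪ ⁅ z ⁆) A
    ≡⟨ ℤP.+-identityˡ _ ⟨
  + 0 + weight G X (Y ∪ ⁅ z ⁆) A
    ≡⟨ cong (λ t → t + weight G X (Y ∪ ⁅ z ⁆) A)
            (weight-inadmissible G (X ∪ ⁅ z ⁆) Y A λ (_ , X⊆A , _) → z∉A (X⊆A (∈-∪⁅⁆ X z))) ⟨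
  weight G (X ∪ ⁅ z ⁆) Y A + weight G X (Y ∪ ⁅ z ⁆) A ∎

f-split : ∀ {n} (G : Graph n) (X Y : Subset n) (z : Fin n) →
  f G X Y ≡ f G (X ∪ ⁅ z ⁆) Y + f G X (Y ∪ ⁅ z ⁆)
f-split {n} G X Y z = begin
  f G X Y                                                       ≡⟨ f-as-sum G X Y ⟩
  sumSubsets n (weight G X Y)                                   ≡⟨ sumSubsets-cong n (weight-split G X Y z) ⟩
  sumSubsets n (λ A → weight G (X ∪ ⁅ z ⁆) Y A + weight G X (Y ∪ ⁅ z ⁆) A)
    ≡⟨ sumSubsets-+ n (weight G (X ∪ ⁅ z ⁆) Y) (weight G X (Y ∪ ⁅ z ⁆)) ⟩
  sumSubsets n (weight G (X ∪ ⁅ z ⁆) Y) + sumSubsets n (weight G X (Y ∪ ⁅ z ⁆))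
    ≡⟨ cong₂ _+_ (f-as-sum G (X ∪ ⁅ z ⁆) Y) (f-as-sum G X (Y ∪ ⁅ z ⁆)) ⟨
  f G (X ∪ ⁅ z ⁆) Y + f G X (Y ∪ ⁅ z ⁆)                         ∎

-- Adjacent: no stable set contains an edge of X.
f-adjacent : ∀ {n} (G : Graph n) (X Y : Subset n) {i j : Fin n} →
  i ∈ X → j ∈ X → adj G i j ≡ true → f G X Y ≡ + 0
f-adjacent {n} G X Y {i} {j} i∈X j∈X i~j = trans (f-as-sum G X Y) (sumSubsets-zero n λ A →
  weight-inadmissible G X Y A λ (s , X⊆A , _) → not-¬ (s i j (X⊆A i∈X) (X⊆A j∈X)) i~j)

-- Pendant: if v ∉ X ∪ Y and all neighbours of v are in Y, toggling v preserves admissibility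
-- and reverses the sign, so f G X Y = -f G X Y.
admissible-toggle : ∀ {n} (G : Graph n) {X Y : Subset n} {v : Fin n} → v ∉ X → v ∉ Y →
  (∀ j → adj G v j ≡ true → j ∈ Y) →
  ∀ {A} → Admissible G X Y A → Admissible G X Y (toggle v A)
admissible-toggle G {X} {Y} {v} v∉X v∉Y N⊆Y {A} (s , X⊆A , d) = stable , X⊆A′ , disjoint
  where
  far-from-v : ∀ {j} → j ∈ A → adj G v j ≡ false
  far-from-v {j} j∈A = ¬-not (λ v~j → d j j∈A (N⊆Y j v~j))

  stable : Stable G (toggle v A)
  stable i j i∈ j∈ with i ≟ᶠ v | j ≟ᶠ v
  ... | yes refl | yes refl = irrefl G i
  ... | yes refl | no j≢v   = far-from-v (toggle-∈ j≢v j∈)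
  ... | no i≢v   | yes refl = trans (symm G i v) (far-from-v (toggle-∈ i≢v i∈))
  ... | no i≢v   | no j≢v   = s i j (toggle-∈ i≢v i∈) (toggle-∈ j≢v j∈)

  X⊆A′ : X ⊆ toggle v A
  X⊆A′ i∈X = ∈-toggle (λ { refl → v∉X i∈X }) (X⊆A i∈X)

  disjoint : Disj (toggle v A) Y
  disjoint i i∈ i∈Y with i ≟ᶠ v
  ... | yes refl = v∉Y i∈Y
  ... | no i≢v   = d i (toggle-∈ i≢v i∈) i∈Y

double-zero : ∀ x → x + x ≡ + 0 → x ≡ + 0
double-zero (+ zero)  _ = refl
double-zero (+ suc n) ()
double-zero -[1+ n ]  ()

f-pendant : ∀ {n} (G : Graph n) (X Y : Subset n) (v : Fin n) → v ∉ X → v ∉ Y →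
  (∀ j → adj G v j ≡ true → j ∈ Y) → f G X Y ≡ + 0
f-pendant {n} G X Y v v∉X v∉Y N⊆Y = double-zero (f G X Y) (begin
  f G X Y + f G X Y
    ≡⟨ cong₂ _+_ (f-as-sum G X Y) (trans (f-as-sum G X Y) (sumSubsets-toggle n v w)) ⟩
  sumSubsets n w + sumSubsets n (w ∘ toggle v)      ≡⟨ sumSubsets-+ n w (w ∘ toggle v) ⟨
  sumSubsets n (λ A → w A + w (toggle v A))         ≡⟨ sumSubsets-zero n cancel ⟩
  + 0                                               ∎)
  where
  w : Subset n → ℤ
  w = weight G X Y
  adm-toggle : ∀ {A} → Admissible G X Y A → Admissible G X Y (toggle v A)
  adm-toggle = admissible-toggle G v∉X v∉Y N⊆Y
  cancel : ∀ A → w A + w (toggle v A) ≡ + 0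
  cancel A with admissible? G X Y A
  ... | yes adm = begin
    w A + w (toggle v A)
      ≡⟨ cong₂ _+_ (weight-admissible G X Y A adm) (weight-admissible G X Y _ (adm-toggle adm)) ⟩
    σ + sign (∣ toggle v A ∣)     ≡⟨ cong (λ t → σ + t) (sign-toggle v A) ⟩
    σ + (- σ)                     ≡⟨ ℤP.+-inverseʳ σ ⟩
    + 0                           ∎
    where σ = sign ∣ A ∣
  ... | no ¬adm = cong₂ _+_ (weight-inadmissible G X Y A ¬adm)
    (weight-inadmissible G X Y _ λ adm′ →
      ¬adm (subst (Admissible G X Y) (toggle-involutive v A) (adm-toggle adm′)))

counter-split : ∀ {n} (G : Graph n) (s : Bool) (X Y : Subset n) (z : Fin n) →
  counter G s X Y ≡ counter G s (X ∪ ⁅ z ⁆) Y + counter G s X (Y ∪ ⁅ z ⁆)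
counter-split G true  X Y z = f-split G X Y z
counter-split G false X Y z =
  trans (cong -_ (f-split G X Y z)) (ℤP.neg-distrib-+ (f G (X ∪ ⁅ z ⁆) Y) (f G X (Y ∪ ⁅ z ⁆)))

counter-zero : ∀ {n} (G : Graph n) (s : Bool) (X Y : Subset n) →
  f G X Y ≡ + 0 → counter G s X Y ≡ + 0
counter-zero G true  X Y f≡0 = f≡0
counter-zero G false X Y f≡0 = cong -_ f≡0

data Status : Set where
  inX inY free : Status

-- The statuses inX, inY are atomic; a free vertex splits into both.
atomic : Bool → Status
atomic true  = inX
atomic false = inY

over : Status → (Bool → ℤ) → ℤ
over inX  k = k true
over inY  k = k false
over free k = k true + k false

over-cong : ∀ p {k k′ : Bool → ℤ} → (∀ b → k b ≡ k′ b) → over p k ≡ over p k′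
over-cong inX  k≗k′ = k≗k′ true
over-cong inY  k≗k′ = k≗k′ false
over-cong free k≗k′ = cong₂ _+_ (k≗k′ true) (k≗k′ false)

over-expand : ∀ {k : Status → ℤ} → k free ≡ k inX + k inY → ∀ p → k p ≡ over p (k ∘ atomic)
over-expand split inX  = refl
over-expand split inY  = refl
over-expand split free = split

extend : (Bool → Bool → Bool → ℤ) → Status → Status → Status → ℤ
extend a p q r = over p λ b₁ → over q λ b₂ → over r λ b₃ → a b₁ b₂ b₃

extend-cong : ∀ {a a′ : Bool → Bool → Bool → ℤ} → (∀ b₁ b₂ b₃ → a b₁ b₂ b₃ ≡ a′ b₁ b₂ b₃) →
  ∀ p q r → extend a p q r ≡ extend a′ p q r
extend-cong a≗a′ p q r = over-cong p λ b₁ → over-cong q λ b₂ → over-cong r λ b₃ → a≗a′ b₁ b₂ b₃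

intoX : ∀ {n} → Status → Fin n → Subset n → Subset n
intoX inX  z S = S ∪ ⁅ z ⁆
intoX inY  z S = S
intoX free z S = S

intoY : ∀ {n} → Status → Fin n → Subset n → Subset n
intoY inX  z S = S
intoY inY  z S = S ∪ ⁅ z ⁆
intoY free z S = S

intoX-∪ : ∀ {n} p (z : Fin n) (S R : Subset n) → intoX p z (S ∪ R) ≡ intoX p z S ∪ R
intoX-∪ inX  z S R = ∪-swap S R ⁅ z ⁆
intoX-∪ inY  z S R = refl
intoX-∪ free z S R = refl

intoY-∪ : ∀ {n} p (z : Fin n) (S R : Subset n) → intoY p z (S ∪ R) ≡ intoY p z S ∪ R
intoY-∪ inX  z S R = refl
intoY-∪ inY  z S R = ∪-swap S R ⁅ z ⁆
intoY-∪ free z S R = refl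

intoX-∉ : ∀ {n} {S : Subset n} {i z : Fin n} → i ∉ S → i ≢ z → ∀ p → i ∉ intoX p z S
intoX-∉ i∉S i≢z inX  = ∉-∪⁅⁆ i∉S i≢z
intoX-∉ i∉S i≢z inY  = i∉S
intoX-∉ i∉S i≢z free = i∉S

intoY-∉ : ∀ {n} {S : Subset n} {i z : Fin n} → i ∉ S → i ≢ z → ∀ p → i ∉ intoY p z S
intoY-∉ i∉S i≢z inX  = i∉S
intoY-∉ i∉S i≢z inY  = ∉-∪⁅⁆ i∉S i≢z
intoY-∉ i∉S i≢z free = i∉S

Disj-into : ∀ {n} {S T : Subset n} {z : Fin n} → Disj S T → z ∉ S → z ∉ T →
  ∀ p → Disj (intoX p z S) (intoY p z T)
Disj-into d z∉S z∉T inX  = Disj-sym (Disj-∪⁅⁆ (Disj-sym d) z∉T)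
Disj-into d z∉S z∉T inY  = Disj-∪⁅⁆ d z∉S
Disj-into d z∉S z∉T free = d

module ThreeVertices {n} (g : Subset n → Subset n → ℤ)
  (split : ∀ X Y z → g X Y ≡ g (X ∪ ⁅ z ⁆) Y + g X (Y ∪ ⁅ z ⁆))
  (X Y : Subset n) (u v w : Fin n) where

  Xs : Status → Status → Status → Subset n
  Xs p q r = intoX p u (intoX q v (intoX r w X))

  Ys : Status → Status → Status → Subset n
  Ys p q r = intoY p u (intoY q v (intoY r w Y))

  V : Status → Status → Status → ℤ
  V p q r = g (Xs p q r) (Ys p q r)

  split-u : ∀ q r → V free q r ≡ V inX q r + V inY q r
  split-u q r = split (Xs free q r) (Ys free q r) u

  split-v : ∀ p r → V p free r ≡ V p inX r + V p inY r
  split-v p r = trans (split (Xs p free r) (Ys p free r) v)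
    (cong₂ _+_ (cong (λ S → g S (Ys p free r)) (sym (intoX-∪ p u _ ⁅ v ⁆)))
               (cong (g (Xs p free r)) (sym (intoY-∪ p u _ ⁅ v ⁆))))

  split-w : ∀ p q → V p q free ≡ V p q inX + V p q inY
  split-w p q = trans (split (Xs p q free) (Ys p q free) w)
    (cong₂ _+_ (cong (λ S → g S (Ys p q free))
                     (sym (trans (cong (intoX p u) (intoX-∪ q v X ⁅ w ⁆)) (intoX-∪ p u _ ⁅ w ⁆))))
               (cong (g (Xs p q free))
                     (sym (trans (cong (intoY p u) (intoY-∪ q v Y ⁅ w ⁆)) (intoY-∪ p u _ ⁅ w ⁆)))))

  atoms : Bool → Bool → Bool → ℤ
  atoms b₁ b₂ b₃ = V (atomic b₁) (atomic b₂) (atomic b₃)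

  expand : ∀ p q r → V p q r ≡ extend atoms p q r
  expand p q r = begin
    V p q r
      ≡⟨ over-expand (split-u q r) p ⟩
    over p (λ b₁ → V (atomic b₁) q r)
      ≡⟨ over-cong p (λ b₁ → over-expand (split-v (atomic b₁) r) q) ⟩
    over p (λ b₁ → over q λ b₂ → V (atomic b₁) (atomic b₂) r)
      ≡⟨ over-cong p (λ b₁ → over-cong q λ b₂ → over-expand (split-w (atomic b₁) (atomic b₂)) r) ⟩
    extend atoms p q r ∎

-- A table of atomic values, indexed by whether u, v, w are in X, whose two entries with v and w
-- both in X are 0.
table : (a₀₀₀ a₁₀₀ a₀₁₀ a₀₀₁ a₁₁₀ a₁₀₁ : ℤ) → Bool → Bool → Bool → ℤ
table a₀₀₀ a₁₀₀ a₀₁₀ a₀₀₁ a₁₁₀ a₁₀₁ false false false = a₀₀₀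
table a₀₀₀ a₁₀₀ a₀₁₀ a₀₀₁ a₁₁₀ a₁₀₁ true  false false = a₁₀₀
table a₀₀₀ a₁₀₀ a₀₁₀ a₀₀₁ a₁₁₀ a₁₀₁ false true  false = a₀₁₀
table a₀₀₀ a₁₀₀ a₀₁₀ a₀₀₁ a₁₁₀ a₁₀₁ false false true  = a₀₀₁
table a₀₀₀ a₁₀₀ a₀₁₀ a₀₀₁ a₁₁₀ a₁₀₁ true  true  false = a₁₁₀
table a₀₀₀ a₁₀₀ a₀₁₀ a₀₀₁ a₁₁₀ a₁₀₁ true  false true  = a₁₀₁
table a₀₀₀ a₁₀₀ a₀₁₀ a₀₀₁ a₁₁₀ a₁₀₁ _     true  true  = + 0

-- The integer constraints available on V in the free-neighbour case, in order: the hypotheses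
-- g(X,Y) = g(X+u+v,Y), ≠ 0 and ≠ g(X+v,Y); goodness (ii) at (X,Y+u) for v, w; the induction
-- hypotheses at (X,Y+v) for w, u and at (X,Y+w) for u, v; goodness (i) at three pairs.
Constraints : (Status → Status → Status → ℤ) → Set
Constraints V =
    V free free free ≡ V inX inX free
  × V free free free ≢ + 0
  × V free free free ≢ V free inX free
  × ℤ.∣ V inY inX free - V inY free inX ∣ ≤ 1
  × (V free inY free ≡ V inX inY inX → V free inY free ≢ + 0 → V free inY free ≡ V inX inY free)
  × (V free free inY ≡ V inX inX inY → V free free inY ≢ + 0 → V free free inY ≡ V free inX inY)
  × ℤ.∣ V inX free free ∣ ≤ 1
  × ℤ.∣ V inX free inY ∣ ≤ 1
  × ℤ.∣ V free inX inY ∣ ≤ 1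

-- The constraints are decidable, which makes the finite check below a computation.
constraints? : ∀ V → Dec (Constraints V)
constraints? V =
      V free free free ℤ.≟ V inX inX free
  ×-dec ¬? (V free free free ℤ.≟ + 0)
  ×-dec ¬? (V free free free ℤ.≟ V free inX free)
  ×-dec ℤ.∣ V inY inX free - V inY free inX ∣ ℕ.≤? 1
  ×-dec (V free inY free ℤ.≟ V inX inY inX →-dec ¬? (V free inY free ℤ.≟ + 0) →-dec V free inY free ℤ.≟ V inX inY free)
  ×-dec (V free free inY ℤ.≟ V inX inX inY →-dec ¬? (V free free inY ℤ.≟ + 0) →-dec V free free inY ℤ.≟ V free inX inY)
  ×-dec ℤ.∣ V inX free free ∣ ℕ.≤? 1
  ×-dec ℤ.∣ V inX free inY ∣ ℕ.≤? 1
  ×-dec ℤ.∣ V free inX inY ∣ ℕ.≤? 1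

Constraints-resp : ∀ {V W : Status → Status → Status → ℤ} → (∀ p q r → V p q r ≡ W p q r) →
  Constraints V → Constraints W
Constraints-resp {V} {W} V≗W (c₁ , c₂ , c₃ , c₄ , c₅ , c₆ , c₇ , c₈ , c₉) =
  toW c₁ , c₂ ∘ toV₀ , c₃ ∘ toV , subst₂ (λ a b → ℤ.∣ a - b ∣ ≤ 1) (V≗W _ _ _) (V≗W _ _ _) c₄ ,
  (λ h₁ h₂ → toW (c₅ (toV h₁) (h₂ ∘ toW₀))) , (λ h₁ h₂ → toW (c₆ (toV h₁) (h₂ ∘ toW₀))) ,
  bound c₇ , bound c₈ , bound c₉
  where
  toW : ∀ {p q r p′ q′ r′} → V p q r ≡ V p′ q′ r′ → W p q r ≡ W p′ q′ r′
  toW e = trans (sym (V≗W _ _ _)) (trans e (V≗W _ _ _))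
  toV : ∀ {p q r p′ q′ r′} → W p q r ≡ W p′ q′ r′ → V p q r ≡ V p′ q′ r′
  toV e = trans (V≗W _ _ _) (trans e (sym (V≗W _ _ _)))
  toW₀ : ∀ {p q r} → V p q r ≡ + 0 → W p q r ≡ + 0
  toW₀ e = trans (sym (V≗W _ _ _)) e
  toV₀ : ∀ {p q r} → W p q r ≡ + 0 → V p q r ≡ + 0
  toV₀ e = trans (V≗W _ _ _) e
  bound : ∀ {p q r} → ℤ.∣ V p q r ∣ ≤ 1 → ℤ.∣ W p q r ∣ ≤ 1
  bound = subst (λ a → ℤ.∣ a ∣ ≤ 1) (V≗W _ _ _)

-- The values allowed by goodness (i).
trit : Fin 3 → ℤ
trit zero             = -[1+ 0 ]
trit (suc zero)       = + 0
trit (suc (suc zero)) = + 1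

trit-onto : ∀ x → ℤ.∣ x ∣ ≤ 1 → Σ (Fin 3) λ t → trit t ≡ x
trit-onto (+ zero)           _         = suc zero , refl
trit-onto (+ suc zero)       _         = suc (suc zero) , refl
trit-onto (+ suc (suc _))    (s≤s ())
trit-onto -[1+ zero ]        _         = zero , refl
trit-onto -[1+ suc _ ]       (s≤s ())

no-trit-table : ∀ t₁ t₂ t₃ t₄ t₅ t₆ →
  ¬ Constraints (extend (table (trit t₁) (trit t₂) (trit t₃) (trit t₄) (trit t₅) (trit t₆)))
no-trit-table = toWitness {a? = all? λ t₁ → all? λ t₂ → all? λ t₃ → all? λ t₄ → all? λ t₅ → all? λ t₆ →
  ¬? (constraints? (extend (table (trit t₁) (trit t₂) (trit t₃) (trit t₄) (trit t₅) (trit t₆))))} tt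

no-bounded-table : ∀ {a₀₀₀ a₁₀₀ a₀₁₀ a₀₀₁ a₁₁₀ a₁₀₁} →
  ℤ.∣ a₀₀₀ ∣ ≤ 1 → ℤ.∣ a₁₀₀ ∣ ≤ 1 → ℤ.∣ a₀₁₀ ∣ ≤ 1 → ℤ.∣ a₀₀₁ ∣ ≤ 1 → ℤ.∣ a₁₁₀ ∣ ≤ 1 → ℤ.∣ a₁₀₁ ∣ ≤ 1 →
  ∀ (V : Status → Status → Status → ℤ) →
  (∀ p q r → V p q r ≡ extend (table a₀₀₀ a₁₀₀ a₀₁₀ a₀₀₁ a₁₁₀ a₁₀₁) p q r) → ¬ Constraints V
no-bounded-table {a₀₀₀} {a₁₀₀} {a₀₁₀} {a₀₀₁} {a₁₁₀} {a₁₀₁} b₁ b₂ b₃ b₄ b₅ b₆ V V≗table c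
  with trit-onto a₀₀₀ b₁ | trit-onto a₁₀₀ b₂ | trit-onto a₀₁₀ b₃
     | trit-onto a₀₀₁ b₄ | trit-onto a₁₁₀ b₅ | trit-onto a₁₀₁ b₆
... | t₁ , refl | t₂ , refl | t₃ , refl | t₄ , refl | t₅ , refl | t₆ , refl =
  no-trit-table t₁ t₂ t₃ t₄ t₅ t₆ (Constraints-resp V≗table c)

Claim : ∀ {n} → (Subset n → Subset n → ℤ) → Subset n → Subset n → Fin n → Fin n → Set
Claim g X Y u v = g X Y ≡ g (X ∪ (⁅ u ⁆ ∪ ⁅ v ⁆)) Y → g X Y ≢ + 0 → g X Y ≡ g (X ∪ ⁅ v ⁆) Y

module GoodCounter {n} (G : Graph n) (s : Bool) (good : Good (counter G s)) where

  g : Subset n → Subset n → ℤ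
  g = counter G s

  module Configuration {X Y : Subset n} (dj : Disj X Y) {u v w : Fin n}
    (u∉ : u ∉ X ∪ Y) (v∉ : v ∉ X ∪ Y) (w∉ : w ∉ X ∪ Y)
    (u≢v : u ≢ v) (u≢w : u ≢ w) (v≢w : v ≢ w) (v~w : adj G v w ≡ true) where

    open ThreeVertices g (counter-split G s) X Y u v w public

    disjoint-at : ∀ p q r → Disj (Xs p q r) (Ys p q r)
    disjoint-at p q r =
      Disj-into (Disj-into (Disj-into dj (∉-∪ˡ w∉) (∉-∪ʳ w∉) r)
                           (intoX-∉ (∉-∪ˡ v∉) v≢w r) (intoY-∉ (∉-∪ʳ v∉) v≢w r) q)
                (intoX-∉ (intoX-∉ (∉-∪ˡ u∉) u≢w r) u≢v q) (intoY-∉ (intoY-∉ (∉-∪ʳ u∉) u≢w r) u≢v q) p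

    bounded : ∀ p q r → NonemptyS (Xs p q r ∪ Ys p q r) → ℤ.∣ V p q r ∣ ≤ 1
    bounded p q r ne = proj₁ (good (Xs p q r) (Ys p q r) (disjoint-at p q r) ne)

    -- Goodness (i) bounds each value in which u is not free (u makes the pair non-empty).
    atom-bounded : ∀ b q r → ℤ.∣ V (atomic b) q r ∣ ≤ 1
    atom-bounded true  q r = bounded inX q r (u , x∈p∪q⁺ (inj₁ (∈-∪⁅⁆ (Xs free q r) u)))
    atom-bounded false q r = bounded inY q r (u , x∈p∪q⁺ (inj₂ (∈-∪⁅⁆ (Ys free q r) u)))

    -- With both v and w added to X the value is 0, by the adjacent identity.
    vanishes : ∀ p → V p inX inX ≡ + 0
    vanishes p = counter-zero G s _ _ (f-adjacent G (Xs p inX inX) (Ys p inX inX) (v∈ p) (w∈ p) v~w)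
      where
      v∈ : ∀ p → v ∈ Xs p inX inX
      v∈ inX  = p⊆p∪q ⁅ u ⁆ (∈-∪⁅⁆ (X ∪ ⁅ w ⁆) v)
      v∈ inY  = ∈-∪⁅⁆ (X ∪ ⁅ w ⁆) v
      v∈ free = ∈-∪⁅⁆ (X ∪ ⁅ w ⁆) v
      w∈ : ∀ p → w ∈ Xs p inX inX
      w∈ inX  = p⊆p∪q ⁅ u ⁆ (p⊆p∪q ⁅ v ⁆ (∈-∪⁅⁆ X w))
      w∈ inY  = p⊆p∪q ⁅ v ⁆ (∈-∪⁅⁆ X w)
      w∈ free = p⊆p∪q ⁅ v ⁆ (∈-∪⁅⁆ X w)

    V-table : Bool → Bool → Bool → ℤ
    V-table = table (V inY inY inY) (V inX inY inY) (V inY inX inY) (V inY inY inX) (V inX inX inY) (V inX inY inX)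

    V≗table : ∀ p q r → V p q r ≡ extend V-table p q r
    V≗table p q r = trans (expand p q r) (extend-cong atoms≗table p q r)
      where
      atoms≗table : ∀ b₁ b₂ b₃ → atoms b₁ b₂ b₃ ≡ V-table b₁ b₂ b₃
      atoms≗table true  true  true  = vanishes inX
      atoms≗table false true  true  = vanishes inY
      atoms≗table true  true  false = refl
      atoms≗table true  false true  = refl
      atoms≗table true  false false = refl
      atoms≗table false true  false = refl
      atoms≗table false false true  = refl
      atoms≗table false false false = refl

  -- Under the hypotheses of the claim v has no neighbour in X ∪ {u, v}: such an edge would
  -- make g(X+u+v,Y) = 0.
  isolated : ∀ {X Y u v} → g X Y ≡ g (X ∪ (⁅ u ⁆ ∪ ⁅ v ⁆)) Y → g X Y ≢ + 0 →
    ∀ {j} → j ∈ X ∪ (⁅ u ⁆ ∪ ⁅ v ⁆) → adj G v j ≡ false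
  isolated {X} {Y} {u} {v} same nz j∈ = ¬-not λ v~j →
    nz (trans same (counter-zero G s _ Y (f-adjacent G _ Y v∈ j∈ v~j)))
    where
    v∈ : v ∈ X ∪ (⁅ u ⁆ ∪ ⁅ v ⁆)
    v∈ = x∈p∪q⁺ (inj₂ (x∈p∪q⁺ (inj₂ (x∈⁅x⁆ v))))

  free-neighbour-case : ∀ {X Y} → Disj X Y → ∀ {u v w} → u ∉ X ∪ Y → v ∉ X ∪ Y → w ∉ X ∪ Y →
    u ≢ v → u ≢ w → v ≢ w → adj G v w ≡ true →
    Claim g X (Y ∪ ⁅ v ⁆) w u → Claim g X (Y ∪ ⁅ w ⁆) u v → Claim g X Y u v
  free-neighbour-case {X} {Y} dj {u} {v} {w} u∉ v∉ w∉ u≢v u≢w v≢w v~w ih₁ ih₂ same nz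
    with g X Y ℤ.≟ g (X ∪ ⁅ v ⁆) Y
  ... | yes done  = done
  ... | no differ = ⊥-elim (no-bounded-table
          (atom-bounded false inY inY) (atom-bounded true inY inY) (atom-bounded false inX inY)
          (atom-bounded false inY inX) (atom-bounded true inX inY) (atom-bounded true inY inX)
          V V≗table constraints)
    where
    open Configuration dj u∉ v∉ w∉ u≢v u≢w v≢w v~w

    uv-shape : X ∪ (⁅ u ⁆ ∪ ⁅ v ⁆) ≡ (X ∪ ⁅ v ⁆) ∪ ⁅ u ⁆
    uv-shape = trans (cong (X ∪_) (∪-comm ⁅ u ⁆ ⁅ v ⁆)) (sym (∪-assoc X ⁅ v ⁆ ⁅ u ⁆))

    constraints : Constraints V
    constraints =
      trans same (cong (λ S → g S Y) uv-shape) , nz , differ ,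
      proj₂ (good X (Y ∪ ⁅ u ⁆) (disjoint-at inY free free) (u , x∈p∪q⁺ (inj₂ (∈-∪⁅⁆ Y u))))
            v w (∉-grow X Y v∉ (u≢v ∘ sym)) (∉-grow X Y w∉ (u≢w ∘ sym)) ,
      (λ h → ih₁ (trans h (cong (λ S → g S (Y ∪ ⁅ v ⁆)) (∪-assoc X ⁅ w ⁆ ⁅ u ⁆)))) ,
      (λ h → ih₂ (trans h (cong (λ S → g S (Y ∪ ⁅ w ⁆)) (sym uv-shape)))) ,
      atom-bounded true free free , atom-bounded true free inY ,
      bounded free inX inY (v , x∈p∪q⁺ (inj₁ (∈-∪⁅⁆ X v)))

  theorem8-acc : ∀ X Y → Acc _⊃_ (X ∪ Y) → Disj X Y → ∀ u v → u ∉ X ∪ Y → v ∉ X ∪ Y → Claim g X Y u v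
  theorem8-acc X Y (acc rec) dj u v u∉ v∉ same nz with u ≟ᶠ v
  ... | yes refl = trans same (cong (λ S → g (X ∪ S) Y) (∪-idem ⁅ u ⁆))
  ... | no u≢v with any? (λ w → (adj G v w 𝔹.≟ true) ×-dec ¬? (w ∈? (X ∪ Y)))
  ...   | yes (w , v~w , w∉) = free-neighbour-case dj u∉ v∉ w∉ u≢v u≢w v≢w v~w ih₁ ih₂ same nz
    where
    v≢w : v ≢ w
    v≢w refl = not-¬ (irrefl G v) v~w
    u≢w : u ≢ w
    u≢w refl = not-¬ (isolated same nz (x∈p∪q⁺ (inj₂ (x∈p∪q⁺ (inj₁ (x∈⁅x⁆ u)))))) v~w
    ih₁ : Claim g X (Y ∪ ⁅ v ⁆) w u
    ih₁ = theorem8-acc X (Y ∪ ⁅ v ⁆) (rec (⊂-grow X Y v∉)) (Disj-∪⁅⁆ dj (∉-∪ˡ v∉))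
                       w u (∉-grow X Y w∉ (v≢w ∘ sym)) (∉-grow X Y u∉ u≢v)
    ih₂ : Claim g X (Y ∪ ⁅ w ⁆) u v
    ih₂ = theorem8-acc X (Y ∪ ⁅ w ⁆) (rec (⊂-grow X Y w∉)) (Disj-∪⁅⁆ dj (∉-∪ˡ w∉))
                       u v (∉-grow X Y u∉ u≢w) (∉-grow X Y v∉ v≢w)
  ...   | no no-free-neighbour =
    ⊥-elim (nz (counter-zero G s X Y (f-pendant G X Y v (∉-∪ˡ v∉) (∉-∪ʳ v∉) neighbours-in-Y)))
    where
    neighbours-in-Y : ∀ j → adj G v j ≡ true → j ∈ Y
    neighbours-in-Y j v~j with j ∈? (X ∪ Y)
    ... | no j∉ = ⊥-elim (no-free-neighbour (j , v~j , j∉))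
    ... | yes j∈ with x∈p∪q⁻ X Y j∈
    ...   | inj₂ j∈Y = j∈Y
    ...   | inj₁ j∈X = ⊥-elim (not-¬ (isolated same nz (x∈p∪q⁺ (inj₁ j∈X))) v~j)

mainTheorem8 : ∀ {n : ℕ} (G : Graph n) (s : Bool) →
    Good (counter G s) →
    ∀ (X Y : Subset n) → Disj X Y →
    ∀ (u v : Fin n) → u ∉ X ∪ Y → v ∉ X ∪ Y →
    counter G s X Y ≡ counter G s (X ∪ (⁅ u ⁆ ∪ ⁅ v ⁆)) Y →
    counter G s X Y ≢ + 0 →
    counter G s X Y ≡ counter G s (X ∪ ⁅ v ⁆) Y
mainTheorem8 G s good X Y dj u v u∉ v∉ =
  GoodCounter.theorem8-acc G s good X Y (⊃-wellFounded (X ∪ Y)) dj u v u∉ v∉
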